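{- Let $\mathcal S$ be a structure for a vocabulary containing the constructor vocabulary $\mathcal C$, and suppose $\mathcal S$ is separated for $\mathcal C$. Then every element $a\in|\mathcal S|$ has at most one $\mathcal C$-decomposition.
   Context: A constructor vocabulary $\mathcal C$ is a finite set of function symbols (constructors) with arities $\ge0$. $|\mathcal S|$ denotes the universe of $\mathcal S$ and $\mathbf c_{\mathcal S}$ the interpretation of $\mathbf c$. $\mathcal S$ is separated for $\mathcal C$ if the interpretations of the constructors are injective and have pairwise disjoint ranges. A $\mathcal C$-decomposition of $a\in|\mathcal S|$ is a finitely-branching (possibly infinite) ordered tree $T$ whose nodes are pairs in $|\mathcal S|\times\mathcal C$, such that the root of $T$ has the form $\langle a,\mathbf c\rangle$, and whenever a node $\langle b,\mathbf c\rangle$ has (in order) the children $\langle b_1,\mathbf c_1\rangle,\dots,\langle b_r,\mathbf c_r\rangle$, then $\mathbf c$ has arity $r$ and $b=\mathbf c_{\mathcal S}(b_1,\dots,b_r)$. -}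

module Defs where

open import Level using (Level; suc)
open import Data.Nat using (ℕ; _<_)
open import Data.Fin using (Fin; toℕ)
open import Data.Vec using (Vec; tabulate)
open import Data.List using (List; []; _∷_)
open import Data.Product using (_×_; proj₁; proj₂)
open import Relation.Binary.PropositionalEquality using (_≡_; _≢_)

record ConstructorVocabulary : Set where
  field
    size  : ℕ
    arity : Fin size → ℕ

  Con : Set
  Con = Fin size

-- The part of a structure S relevant to C: its universe |S| and the
-- interpretations c_S : |S|^arity(c) → |S| of the constructors.
-- (S may interpret further symbols of a larger vocabulary; they play no role.)
record Structure (𝒞 : ConstructorVocabulary) (ℓ : Level) : Set (suc ℓ) where
  open ConstructorVocabulary 𝒞
  field
    Carrier : Set ℓ
    interp  : (c : Con) → Vec Carrier (arity c) → Carrier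

-- Finitely-branching, possibly infinite, ordered labelled trees.
--
-- A node is addressed by a path of child indices, written in REVERSE order:
-- []      is the root,
-- i ∷ p   is the i-th child (0-based) of the node with address p.
-- A tree gives, for each address, a label and the (finite) number of
-- children; only the addresses generated from the root via 'Addr' are
-- nodes of the tree (values at other lists are irrelevant junk).

record Tree {a} (A : Set a) : Set a where
  field
    label  : List ℕ → A
    degree : List ℕ → ℕ
open Tree public

data Addr {a} {A : Set a} (T : Tree A) : List ℕ → Set where
  root  : Addr T []
  child : ∀ {p} (i : ℕ) → Addr T p → i < degree T p → Addr T (i ∷ p)

_≈T_ : ∀ {a} {A : Set a} → Tree A → Tree A → Set a
T ≈T U = ∀ p → Addr T p → (degree T p ≡ degree U p) × (label T p ≡ label U p)

module _ {𝒞 : ConstructorVocabulary} {ℓ : Level} (𝒮 : Structure 𝒞 ℓ) where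
  open ConstructorVocabulary 𝒞
  open Structure 𝒮

  Separated : Set ℓ
  Separated =
    (∀ (c : Con) (xs ys : Vec Carrier (arity c)) → interp c xs ≡ interp c ys → xs ≡ ys)
    × (∀ (c d : Con) (xs : Vec Carrier (arity c)) (ys : Vec Carrier (arity d)) →
         c ≢ d → interp c xs ≢ interp d ys)

  Node : Set ℓ
  Node = Carrier × Con

  record IsDecomposition (a : Carrier) (T : Tree Node) : Set ℓ where
    field
      root-≡  : proj₁ (label T []) ≡ a
      arity-≡ : ∀ p → Addr T p → degree T p ≡ arity (proj₂ (label T p))
      node-≡  : ∀ p → Addr T p →
                proj₁ (label T p) ≡
                interp (proj₂ (label T p))
                       (tabulate (λ i → proj₁ (label T (toℕ i ∷ p))))

-- Walk down both trees from the common root. At a node shared by the two trees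
-- and carrying the same element b, both constructors c, c' satisfy b = c_S(…) =
-- c'_S(…), so disjointness of ranges forces c = c' (hence the same number of
-- children) and injectivity of c_S forces equal elements at every child.
module Submission where

open import Defs
open import Level using (Level)
open import Function using (_∘_)
open import Data.Nat using (ℕ; _<_)
open import Data.Fin using (Fin; toℕ; fromℕ<; _≟_)
open import Data.Fin.Properties using (toℕ-fromℕ<)
open import Data.List using (List; _∷_)
open import Data.Vec using (Vec; tabulate; lookup)
open import Data.Vec.Properties using (lookup∘tabulate)
open import Data.Product using (_×_; _,_; proj₁; proj₂)
open import Relation.Nullary using (yes; no; contradiction)
open import Relation.Binary.PropositionalEquality

tabulate-toℕ-injective : ∀ {a} {A : Set a} {n} (f g : ℕ → A) →
  tabulate {n = n} (f ∘ toℕ) ≡ tabulate (g ∘ toℕ) → ∀ {i} → i < n → f i ≡ g i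
tabulate-toℕ-injective {n = n} f g eq {i} i<n = begin
  f i                                    ≡⟨ cong f (toℕ-fromℕ< i<n) ⟨
  f (toℕ j)                              ≡⟨ lookup∘tabulate (f ∘ toℕ) j ⟨
  lookup (tabulate (f ∘ toℕ)) j          ≡⟨ cong (λ v → lookup v j) eq ⟩
  lookup (tabulate (g ∘ toℕ)) j          ≡⟨ lookup∘tabulate (g ∘ toℕ) j ⟩
  g (toℕ j)                              ≡⟨ cong g (toℕ-fromℕ< i<n) ⟩
  g i                                    ∎
  where
  open ≡-Reasoning
  j : Fin n
  j = fromℕ< i<n

element : ∀ {a b} {A : Set a} {B : Set b} → Tree (A × B) → List ℕ → A
element V p = proj₁ (label V p)

con : ∀ {a b} {A : Set a} {B : Set b} → Tree (A × B) → List ℕ → B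
con V p = proj₂ (label V p)

module _ {𝒞 : ConstructorVocabulary} {ℓ : Level} {𝒮 : Structure 𝒞 ℓ}
         (sep : Separated 𝒮) where
  open ConstructorVocabulary 𝒞
  open Structure 𝒮

  Separated⇒con-≡ : ∀ {c d} {xs : Vec Carrier (arity c)} {ys : Vec Carrier (arity d)} →
                    interp c xs ≡ interp d ys → c ≡ d
  Separated⇒con-≡ {c} {d} eq with c ≟ d
  ... | yes c≡d = c≡d
  ... | no  c≢d = contradiction eq (proj₂ sep c d _ _ c≢d)

  Separated⇒args-≡ : ∀ {c d} (f g : ℕ → Carrier) →
                     interp c (tabulate (f ∘ toℕ)) ≡ interp d (tabulate (g ∘ toℕ)) →
                     ∀ {i} → i < arity c → f i ≡ g i
  Separated⇒args-≡ {c} f g eq with Separated⇒con-≡ eq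
  ... | refl = tabulate-toℕ-injective f g (proj₁ sep c _ _ eq)

  module _ {a : Carrier} {T U : Tree (Node 𝒮)}
           (dT : IsDecomposition 𝒮 a T) (dU : IsDecomposition 𝒮 a U) where
    private
      module DT = IsDecomposition dT
      module DU = IsDecomposition dU

    interp-≡ : ∀ {p} → Addr T p → Addr U p → element T p ≡ element U p →
               interp (con T p) (tabulate (λ i → element T (toℕ i ∷ p))) ≡
               interp (con U p) (tabulate (λ i → element U (toℕ i ∷ p)))
    interp-≡ {p} aT aU eq = trans (sym (DT.node-≡ p aT)) (trans eq (DU.node-≡ p aU))

    con-≡ : ∀ {p} → Addr T p → Addr U p → element T p ≡ element U p → con T p ≡ con U p
    con-≡ aT aU eq = Separated⇒con-≡ (interp-≡ aT aU eq)

    degree-≡ : ∀ {p} → Addr T p → Addr U p → element T p ≡ element U p →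
               degree T p ≡ degree U p
    degree-≡ {p} aT aU eq = begin
      degree T p      ≡⟨ DT.arity-≡ p aT ⟩
      arity (con T p) ≡⟨ cong arity (con-≡ aT aU eq) ⟩
      arity (con U p) ≡⟨ DU.arity-≡ p aU ⟨
      degree U p      ∎
      where open ≡-Reasoning

    shared-node : ∀ {p} → Addr T p → Addr U p × (element T p ≡ element U p)
    shared-node root = root , trans DT.root-≡ (sym DU.root-≡)
    shared-node {i ∷ p} (child i aT i<deg) with shared-node aT
    ... | aU , eq = child i aU (subst (i <_) (degree-≡ aT aU eq) i<deg)
                  , Separated⇒args-≡ (λ k → element T (k ∷ p)) (λ k → element U (k ∷ p))
                      (interp-≡ aT aU eq) (subst (i <_) (DT.arity-≡ p aT) i<deg)

proposition4p1 : {𝒞 : ConstructorVocabulary} {ℓ : Level} (𝒮 : Structure 𝒞 ℓ) →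
    Separated 𝒮 →
    (a : Structure.Carrier 𝒮) (T U : Tree (Node 𝒮)) →
    IsDecomposition 𝒮 a T → IsDecomposition 𝒮 a U → T ≈T U
proposition4p1 𝒮 sep a T U dT dU p aT with shared-node sep dT dU aT
... | aU , eq = degree-≡ sep dT dU aT aU eq , cong₂ _,_ eq (con-≡ sep dT dU aT aU eq)
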